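{- For natural numbers $t,l,n$ with $1\le t<n$, and $s=\lceil \log_2 t\rceil$, one has $\beth(t,l,n)\le \beth(2^s,\,l+1,\,2^s(n-1)+1)$.
   Context: For a linearly ordered $L$-letter alphabet, with lexicographic order on words ($u\succ v$ iff $u=wau'$, $v=wbv'$ with letters $a\succ b$): a word is acyclic if it is not of the form $v^j$ with $j\ge2$. A class $X(t,L)$ is a finite sequence $(C_1,\dots,C_m)$ of acyclic words of length $t$ which are pairwise not cyclic shifts of one another. For $1\le i\le m$, $1\le j\le t$ let $w(i,j)$ be the cyclic shift of $C_i$ beginning at its $j$-th letter; order these by $w(i,j)\prec w(i',j')$ iff $w(i,j)$ is lexicographically smaller than $w(i',j')$ and $i<i'$. The class is $N$-light if this poset has no antichain with $N$ elements. $\beth(t,L,N)$ is the largest possible $m$ for an $N$-light class $X(t,L)$ (supremum in $\mathbb N\cup\{\infty\}$). Throughout, the first argument of $\beth$ is assumed smaller than the third. -}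

module Defs where

open import Data.Nat using (ℕ; _≤_; _<_; _*_)
open import Data.Fin as F using (Fin)
open import Data.List using (List; _∷_; _++_; length; drop; take; concat; replicate)
open import Data.Product using (Σ; ∃; ∃-syntax; _×_; _,_)
open import Relation.Binary.PropositionalEquality using (_≡_; _≢_)
open import Relation.Nullary using (¬_)

Word : ℕ → Set
Word L = List (Fin L)

LexGt : ∀ {L} → Word L → Word L → Set
LexGt {L} u v = ∃[ w ] ∃[ a ] ∃[ b ] ∃[ u' ] ∃[ v' ]
  (u ≡ w ++ (a ∷ u')) × (v ≡ w ++ (b ∷ v')) × (b F.< a)

Acyclic : ∀ {L} → Word L → Set
Acyclic {L} u = ¬ (∃[ v ] ∃[ j ] (2 ≤ j) × (u ≡ concat (replicate j v)))

-- Cyclic shift of a word beginning at its (j+1)-th letter (0-indexed j).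
rotate : ∀ {L} → ℕ → Word L → Word L
rotate j u = drop j u ++ take j u

record IsClass (t L m : ℕ) (C : Fin m → Word L) : Set where
  field
    len       : ∀ i → length (C i) ≡ t
    acyclic   : ∀ i → Acyclic (C i)
    noShifts  : ∀ i i' → i ≢ i' → ¬ (∃[ j ] (j < t) × (C i' ≡ rotate j (C i)))

-- w(i,j), with i and j 0-indexed.
wd : ∀ {t L m} → (Fin m → Word L) → Fin m × Fin t → Word L
wd C (i , j) = rotate (F.toℕ j) (C i)

Prec : ∀ {t L m} → (Fin m → Word L) → Fin m × Fin t → Fin m × Fin t → Set
Prec C (i , j) (i' , j') = LexGt (wd C (i' , j')) (wd C (i , j)) × (i F.< i')

Antichain : ∀ {t L m} → (Fin m → Word L) → (N : ℕ) → (Fin N → Fin m × Fin t) → Set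
Antichain C N a = (∀ p q → p ≢ q → a p ≢ a q) × (∀ p q → ¬ Prec C (a p) (a q))

Light : (t L N m : ℕ) → (Fin m → Word L) → Set
Light t L N m C = ¬ (∃[ a ] Antichain {t} C N a)

-- m is attained: there is an N-light class X(t,L) with m words.
-- ℶ(t,L,N) is the supremum (in ℕ ∪ {∞}) of all attained m.
Attained : (t L N m : ℕ) → Set
Attained t L N m = ∃[ C ] IsClass t L m C × Light t L N m C

module Submission where

-- Adjoin a new letter 0 below the l old letters (which shift up by one) and
-- pad every word of an n-light class C₁,…,Cₘ ⊆ X(t,l) on the right with T ∸ t
-- zeros.  Erasing the new letter ('strip') is a concatenation homomorphism
-- inverting the padding, and it maps the cyclic shift by c of a padded word to
-- the shift of the original word by its "shadow" j (j = c if c < t, else 0).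
--  * Class: a period or a cyclic-shift relation among padded words descends,
--    via strip, to the original words.
--  * Lightness: in an antichain of T(n−1)+1 padded shifts, some shift index c
--    occurs n times (pigeonhole over the T indices).  Replacing c by its shadow
--    j gives an antichain of size n in the original class, since comparing
--    original shifts by j refines to comparing padded shifts by c.

open import Defs
open import Data.Nat using (ℕ; zero; suc; _≤_; _<_; _+_; _*_; _∸_; _^_; z≤n; s≤s; ⌊_/2⌋; ⌈_/2⌉; _≟_; _<?_)
open import Data.Nat.Properties
open import Data.Nat.Logarithm using (⌈log₂_⌉; ⌈log₂⌉-mono-≤; ⌈log₂⌈n/2⌉⌉≡⌈log₂n⌉∸1)
open import Data.Nat.Induction using (<-rec)
open import Data.Fin as F using (Fin)
open import Data.Fin.Properties using (toℕ-fromℕ<; toℕ-injective; toℕ<n)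
open import Data.Maybe using (Maybe; just; nothing)
open import Data.List using (List; []; _∷_; _++_; length; drop; take; concat; replicate; map; mapMaybe; filter; lookup; allFin)
open import Data.List.Properties using (map-++; ∷-injective; ++-assoc; ++-identityʳ; length-map; length-++; length-replicate; length-drop; take-map; drop-map; mapMaybe-++; mapMaybe-map-retract; length-tabulate)
open import Data.List.Relation.Unary.All as All using (All; _∷_)
import Data.List.Relation.Unary.All.Properties as AllP
open import Data.List.Relation.Unary.AllPairs using (_∷_)
open import Data.List.Relation.Unary.Unique.Propositional using (Unique)
import Data.List.Relation.Unary.Unique.Propositional.Properties as UniqueP
open import Data.List.Membership.Propositional.Properties using (∈-lookup)
open import Data.Product using (Σ; ∃-syntax; _×_; _,_; proj₁; proj₂)
open import Data.Sum using (_⊎_; inj₁; inj₂)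
open import Data.Empty using (⊥-elim)
open import Function.Definitions using (Injective)
open import Relation.Binary.PropositionalEquality
open import Relation.Nullary using (¬_; yes; no)
open import Relation.Unary using (Decidable)
open import Relation.Unary.Properties using (∁?)

lex-map : ∀ {L} {u' u : Word L} → LexGt u' u → LexGt (map F.suc u') (map F.suc u)
lex-map (w , a , b , r' , r , refl , refl , b<a) =
  map F.suc w , F.suc a , F.suc b , map F.suc r' , map F.suc r ,
  map-++ F.suc w (a ∷ r') , map-++ F.suc w (b ∷ r) , s≤s b<a

-- A strict comparison is decided before any appended suffixes are reached.
lex-++ʳ : ∀ {L} {u' u : Word L} s' s → LexGt u' u → LexGt (u' ++ s') (u ++ s)
lex-++ʳ s' s (w , a , b , r' , r , refl , refl , b<a) =
  w , a , b , r' ++ s' , r ++ s , ++-assoc w (a ∷ r') s' , ++-assoc w (b ∷ r) s , b<a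

lex-++ˡ : ∀ {L} {u' u : Word L} p → LexGt u' u → LexGt (p ++ u') (p ++ u)
lex-++ˡ p (w , a , b , r' , r , refl , refl , b<a) =
  p ++ w , a , b , r' , r , sym (++-assoc p w (a ∷ r')) , sym (++-assoc p w (b ∷ r)) , b<a

lex-split : ∀ {L} (x' x y' y : Word L) → length x' ≡ length x → LexGt (x' ++ y') (x ++ y) →
  LexGt x' x ⊎ (x' ≡ x × LexGt y' y)
lex-split [] [] y' y _ y'>y = inj₂ (refl , y'>y)
lex-split (a' ∷ x') (a ∷ x) y' y _ ([] , _ , _ , _ , _ , e' , e , b<a)
  with ∷-injective e' | ∷-injective e
... | refl , _ | refl , _ = inj₁ ([] , a' , a , x' , x , refl , refl , b<a)
lex-split (a' ∷ x') (a ∷ x) y' y |x'|≡|x| (_ ∷ w , c , d , r' , r , e' , e , d<c)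
  with ∷-injective e' | ∷-injective e
... | refl , e'ₜ | refl , eₜ
  with lex-split x' x y' y (suc-injective |x'|≡|x|) (w , c , d , r' , r , e'ₜ , eₜ , d<c)
... | inj₁ x'>x = inj₁ (lex-++ˡ (a' ∷ []) x'>x)
... | inj₂ (refl , y'>y) = inj₂ (refl , y'>y)

lex-insert : ∀ {L} (x' x y' y z : Word L) → length x' ≡ length x →
  LexGt (x' ++ y') (x ++ y) → LexGt (x' ++ z ++ y') (x ++ z ++ y)
lex-insert x' x y' y z |x'|≡|x| gt with lex-split x' x y' y |x'|≡|x| gt
... | inj₁ x'>x = lex-++ʳ (z ++ y') (z ++ y) x'>x
... | inj₂ (refl , y'>y) = lex-++ˡ x' (lex-++ˡ z y'>y)

drop-++-≤ : ∀ {A : Set} j (xs ys : List A) → j ≤ length xs → drop j (xs ++ ys) ≡ drop j xs ++ ys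
drop-++-≤ zero xs ys _ = refl
drop-++-≤ (suc j) (x ∷ xs) ys (s≤s j≤) = drop-++-≤ j xs ys j≤

take-++-≤ : ∀ {A : Set} j (xs ys : List A) → j ≤ length xs → take j (xs ++ ys) ≡ take j xs
take-++-≤ zero xs ys _ = refl
take-++-≤ (suc j) (x ∷ xs) ys (s≤s j≤) = cong (x ∷_) (take-++-≤ j xs ys j≤)

drop-++-+ : ∀ {A : Set} (xs ys : List A) d → drop (length xs + d) (xs ++ ys) ≡ drop d ys
drop-++-+ [] ys d = refl
drop-++-+ (x ∷ xs) ys d = drop-++-+ xs ys d

take-++-+ : ∀ {A : Set} (xs ys : List A) d → take (length xs + d) (xs ++ ys) ≡ xs ++ take d ys
take-++-+ [] ys d = refl
take-++-+ (x ∷ xs) ys d = cong (x ∷_) (take-++-+ xs ys d)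

zeros : ∀ {L} → ℕ → Word (suc L)
zeros k = replicate k F.zero

pad : ∀ {L} → ℕ → Word L → Word (suc L)
pad k w = map F.suc w ++ zeros k

unshift : ∀ {L} → Fin (suc L) → Maybe (Fin L)
unshift F.zero = nothing
unshift (F.suc a) = just a

strip : ∀ {L} → Word (suc L) → Word L
strip = mapMaybe unshift

strip-++ : ∀ {L} (u v : Word (suc L)) → strip (u ++ v) ≡ strip u ++ strip v
strip-++ = mapMaybe-++ unshift

strip-++₃ : ∀ {L} (u v w : Word (suc L)) → strip (u ++ v ++ w) ≡ strip u ++ strip v ++ strip w
strip-++₃ u v w = trans (strip-++ u (v ++ w)) (cong (strip u ++_) (strip-++ v w))

strip-suc : ∀ {L} (w : Word L) → strip (map F.suc w) ≡ w
strip-suc = mapMaybe-map-retract (λ _ → refl)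

strip-zeros : ∀ {L} k → strip {L} (zeros k) ≡ []
strip-zeros zero = refl
strip-zeros (suc k) = strip-zeros k

strip-pad : ∀ {L} k (w : Word L) → strip (pad k w) ≡ w
strip-pad k w = begin
  strip (map F.suc w ++ zeros k)      ≡⟨ strip-++ (map F.suc w) (zeros k) ⟩
  strip (map F.suc w) ++ strip (zeros k) ≡⟨ cong₂ _++_ (strip-suc w) (strip-zeros k) ⟩
  w ++ []                             ≡⟨ ++-identityʳ w ⟩
  w                                   ∎
  where open ≡-Reasoning

strip-power : ∀ {L} j (v : Word (suc L)) → strip (concat (replicate j v)) ≡ concat (replicate j (strip v))
strip-power zero v = refl
strip-power (suc j) v = trans (strip-++ v _) (cong (strip v ++_) (strip-power j v))

strip-zeros-split : ∀ {L} d k → strip {L} (take d (zeros k)) ≡ [] × strip {L} (drop d (zeros k)) ≡ []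
strip-zeros-split zero k = refl , strip-zeros k
strip-zeros-split (suc d) zero = refl , refl
strip-zeros-split (suc d) (suc k) = strip-zeros-split d k

rotate-pad-low : ∀ {L} k (w : Word L) c → c ≤ length w →
  rotate c (pad k w) ≡ map F.suc (drop c w) ++ zeros k ++ map F.suc (take c w)
rotate-pad-low k w c c≤ = begin
  drop c (map F.suc w ++ zeros k) ++ take c (map F.suc w ++ zeros k)
    ≡⟨ cong₂ _++_ (drop-++-≤ c (map F.suc w) _ c≤') (take-++-≤ c (map F.suc w) _ c≤') ⟩
  (drop c (map F.suc w) ++ zeros k) ++ take c (map F.suc w)
    ≡⟨ ++-assoc (drop c (map F.suc w)) _ _ ⟩
  drop c (map F.suc w) ++ zeros k ++ take c (map F.suc w)
    ≡⟨ cong₂ (λ x y → x ++ zeros k ++ y) (drop-map c w) (take-map c w) ⟩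
  map F.suc (drop c w) ++ zeros k ++ map F.suc (take c w) ∎
  where
  open ≡-Reasoning
  c≤' : c ≤ length (map F.suc w)
  c≤' = ≤-trans c≤ (≤-reflexive (sym (length-map F.suc w)))

rotate-pad-high : ∀ {L t} k (w : Word L) c → length w ≡ t → t ≤ c →
  rotate c (pad k w) ≡ drop (c ∸ t) (zeros k) ++ map F.suc w ++ take (c ∸ t) (zeros k)
rotate-pad-high k w c refl |w|≤c = begin
  rotate c (pad k w)
    ≡⟨ cong (λ x → rotate x (pad k w)) (sym c≡) ⟩
  rotate (length (map F.suc w) + d) (map F.suc w ++ zeros k)
    ≡⟨ cong₂ _++_ (drop-++-+ (map F.suc w) _ d) (take-++-+ (map F.suc w) _ d) ⟩
  drop d (zeros k) ++ map F.suc w ++ take d (zeros k) ∎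
  where
  open ≡-Reasoning
  d = c ∸ length w
  c≡ : length (map F.suc w) + d ≡ c
  c≡ = trans (cong (_+ d) (length-map F.suc w)) (m+[n∸m]≡n |w|≤c)

data Shadow (t c j : ℕ) : Set where
  below : c < t → j ≡ c → Shadow t c j
  above : t ≤ c → j ≡ 0 → Shadow t c j

shadow : ∀ {t} → 1 ≤ t → ∀ c → ∃[ j ] Shadow t c (F.toℕ {t} j)
shadow {t} 1≤t c with c <? t
... | yes c<t = F.fromℕ< c<t , below c<t (toℕ-fromℕ< c<t)
... | no c≮t = F.fromℕ< 1≤t , above (≮⇒≥ c≮t) (toℕ-fromℕ< 1≤t)

strip-rotate-pad : ∀ {L t c j} k (w : Word L) → length w ≡ t → Shadow t c j →
  strip (rotate c (pad k w)) ≡ rotate j w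
strip-rotate-pad {c = c} k w refl (below c<t refl) = begin
  strip (rotate c (pad k w))
    ≡⟨ cong strip (rotate-pad-low k w c (<⇒≤ c<t)) ⟩
  strip (map F.suc (drop c w) ++ zeros k ++ map F.suc (take c w))
    ≡⟨ strip-++₃ (map F.suc (drop c w)) (zeros k) (map F.suc (take c w)) ⟩
  strip (map F.suc (drop c w)) ++ strip (zeros k) ++ strip (map F.suc (take c w))
    ≡⟨ cong₂ _++_ (strip-suc (drop c w)) (cong₂ _++_ (strip-zeros k) (strip-suc (take c w))) ⟩
  rotate c w ∎
  where open ≡-Reasoning
strip-rotate-pad {c = c} k w refl (above |w|≤c refl) = begin
  strip (rotate c (pad k w))
    ≡⟨ cong strip (rotate-pad-high k w c refl |w|≤c) ⟩
  strip (drop d (zeros k) ++ map F.suc w ++ take d (zeros k))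
    ≡⟨ strip-++₃ (drop d (zeros k)) (map F.suc w) (take d (zeros k)) ⟩
  strip (drop d (zeros k)) ++ strip (map F.suc w) ++ strip (take d (zeros k))
    ≡⟨ cong₂ _++_ (proj₂ (strip-zeros-split d k)) (cong₂ _++_ (strip-suc w) (proj₁ (strip-zeros-split d k))) ⟩
  w ++ []
    ≡⟨⟩
  rotate 0 w ∎
  where
  open ≡-Reasoning
  d = c ∸ length w

lex-rotate-pad : ∀ {L t c j} k (w w' : Word L) → length w ≡ t → length w' ≡ t → Shadow t c j →
  LexGt (rotate j w') (rotate j w) → LexGt (rotate c (pad k w')) (rotate c (pad k w))
lex-rotate-pad {c = c} k w w' refl |w'| (below c<t refl) gt =
  subst₂ LexGt (sym (rotate-pad-low k w' c (≤-trans (<⇒≤ c<t) (≤-reflexive (sym |w'|)))))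
               (sym (rotate-pad-low k w c (<⇒≤ c<t)))
    (lex-insert (map F.suc (drop c w')) (map F.suc (drop c w)) _ _ (zeros k) same-length
      (subst₂ LexGt (map-++ F.suc (drop c w') _) (map-++ F.suc (drop c w) _) (lex-map gt)))
  where
  same-length : length (map F.suc (drop c w')) ≡ length (map F.suc (drop c w))
  same-length = begin
    length (map F.suc (drop c w')) ≡⟨ length-map F.suc (drop c w') ⟩
    length (drop c w')             ≡⟨ length-drop c w' ⟩
    length w' ∸ c                  ≡⟨ cong (_∸ c) |w'| ⟩
    length w ∸ c                   ≡⟨ sym (length-drop c w) ⟩
    length (drop c w)              ≡⟨ sym (length-map F.suc (drop c w)) ⟩
    length (map F.suc (drop c w))  ∎
    where open ≡-Reasoning
lex-rotate-pad {t = t} {c = c} k w w' |w| |w'| (above t≤c refl) gt =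
  subst₂ LexGt (sym (rotate-pad-high k w' c |w'| t≤c)) (sym (rotate-pad-high k w c |w| t≤c))
    (lex-++ˡ (drop d (zeros k)) (lex-++ʳ (take d (zeros k)) (take d (zeros k))
      (lex-map (subst₂ LexGt (++-identityʳ w') (++-identityʳ w) gt))))
  where d = c ∸ t

length-filter-∁ : ∀ {A : Set} {P : A → Set} (P? : Decidable P) (xs : List A) →
  length (filter P? xs) + length (filter (∁? P?) xs) ≡ length xs
length-filter-∁ P? [] = refl
length-filter-∁ P? (x ∷ xs) with P? x
... | yes _ = cong suc (length-filter-∁ P? xs)
... | no _ = trans (+-suc _ _) (cong suc (length-filter-∁ P? xs))

pigeonhole-list : ∀ {A : Set} (f : A → ℕ) T n (xs : List A) → Unique xs → All (λ x → f x < T) xs →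
  T * n < length xs → ∃[ c ] ∃[ ys ] Unique ys × All (λ x → f x ≡ c) ys × n < length ys
pigeonhole-list f zero n [] _ _ ()
pigeonhole-list f zero n (x ∷ xs) _ (() ∷ _) _
pigeonhole-list f (suc T) n xs uniq bounded large
  with n <? length (filter (λ x → f x ≟ T) xs)
... | yes fibre-large =
  T , _ , UniqueP.filter⁺ (λ x → f x ≟ T) uniq , AllP.all-filter (λ x → f x ≟ T) xs , fibre-large
... | no fibre-small = pigeonhole-list f T n rest (UniqueP.filter⁺ (∁? (λ x → f x ≟ T)) uniq) rest-bounded rest-large
  where
  rest = filter (∁? (λ x → f x ≟ T)) xs
  rest-bounded : All (λ x → f x < T) rest
  rest-bounded = All.zipWith (λ (fx<1+T , fx≢T) → ≤∧≢⇒< (m<1+n⇒m≤n fx<1+T) fx≢T)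
    (AllP.filter⁺ (∁? (λ x → f x ≟ T)) bounded , AllP.all-filter (∁? (λ x → f x ≟ T)) xs)
  rest-large : T * n < length rest
  rest-large = +-cancelˡ-< n (T * n) (length rest) (<-≤-trans large (begin
    length xs ≡⟨ sym (length-filter-∁ (λ x → f x ≟ T) xs) ⟩
    length (filter (λ x → f x ≟ T) xs) + length rest ≤⟨ +-monoˡ-≤ (length rest) (≮⇒≥ fibre-small) ⟩
    n + length rest ∎))
    where open ≤-Reasoning

lookup-injective : ∀ {A : Set} (xs : List A) → Unique xs → ∀ i j → lookup xs i ≡ lookup xs j → i ≡ j
lookup-injective (x ∷ xs) (x∉xs ∷ _) F.zero F.zero _ = refl
lookup-injective (x ∷ xs) (x∉xs ∷ _) F.zero (F.suc j) eq = ⊥-elim (All.lookup x∉xs (∈-lookup j) eq)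
lookup-injective (x ∷ xs) (x∉xs ∷ _) (F.suc i) F.zero eq = ⊥-elim (All.lookup x∉xs (∈-lookup i) (sym eq))
lookup-injective (x ∷ xs) (_ ∷ uniq) (F.suc i) (F.suc j) eq = cong F.suc (lookup-injective xs uniq i j eq)

pigeonhole : ∀ {N T} n (g : Fin N → Fin T) → T * n < N →
  ∃[ c ] Σ (Fin (suc n) → Fin N) λ e → Injective _≡_ _≡_ e × (∀ q → F.toℕ (g (e q)) ≡ c)
pigeonhole {N} {T} n g large
  with pigeonhole-list (λ i → F.toℕ (g i)) T n (allFin N) (UniqueP.allFin⁺ N)
         (AllP.tabulate⁺ (λ i → toℕ<n (g i)))
         (<-≤-trans large (≤-reflexive (sym (length-tabulate (λ i → i)))))
... | c , ys , uniq , constant , n<|ys| = c , e , e-injective , λ q → All.lookup constant (∈-lookup _)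
  where
  position : Fin (suc n) → Fin (length ys)
  position q = F.fromℕ< (<-≤-trans (toℕ<n q) n<|ys|)
  e : Fin (suc n) → Fin N
  e q = lookup ys (position q)
  e-injective : Injective _≡_ _≡_ e
  e-injective {p} {q} ep≡eq = toℕ-injective (begin
    F.toℕ p            ≡⟨ sym (toℕ-fromℕ< _) ⟩
    F.toℕ (position p) ≡⟨ cong F.toℕ (lookup-injective ys uniq _ _ ep≡eq) ⟩
    F.toℕ (position q) ≡⟨ toℕ-fromℕ< _ ⟩
    F.toℕ q            ∎)
    where open ≡-Reasoning

n≤2^⌈log₂n⌉ : ∀ n → n ≤ 2 ^ ⌈log₂ n ⌉
n≤2^⌈log₂n⌉ = <-rec (λ n → n ≤ 2 ^ ⌈log₂ n ⌉) step
  where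
  step : ∀ n → (∀ {h} → h < n → h ≤ 2 ^ ⌈log₂ h ⌉) → n ≤ 2 ^ ⌈log₂ n ⌉
  step zero _ = z≤n
  step (suc zero) _ = s≤s z≤n
  step n@(suc (suc m)) ih = begin
    n                               ≡⟨ sym (⌊n/2⌋+⌈n/2⌉≡n n) ⟩
    ⌊ n /2⌋ + h                     ≤⟨ +-monoˡ-≤ h (⌊n/2⌋≤⌈n/2⌉ n) ⟩
    h + h                           ≤⟨ +-mono-≤ (ih {h} (⌈n/2⌉<n m)) (ih {h} (⌈n/2⌉<n m)) ⟩
    2 ^ k' + 2 ^ k'                 ≡⟨ cong (λ x → 2 ^ k' + x) (sym (+-identityʳ (2 ^ k'))) ⟩
    2 ^ suc k'                      ≡⟨ cong (2 ^_) (trans (cong suc (⌈log₂⌈n/2⌉⌉≡⌈log₂n⌉∸1 n)) (m+[n∸m]≡n 1≤k)) ⟩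
    2 ^ ⌈log₂ n ⌉                   ∎
    where
    open ≤-Reasoning
    h = ⌈ n /2⌉
    k' = ⌈log₂ h ⌉
    1≤k : 1 ≤ ⌈log₂ n ⌉
    1≤k = ⌈log₂⌉-mono-≤ {2} {n} (s≤s (s≤s z≤n))

padClass : ∀ {L m} (t T : ℕ) → (Fin m → Word L) → Fin m → Word (suc L)
padClass t T C i = pad (T ∸ t) (C i)

padClass-isClass : ∀ {t T L m} (C : Fin m → Word L) → 1 ≤ t → t ≤ T →
  IsClass t L m C → IsClass T (suc L) m (padClass t T C)
padClass-isClass {t} {T} C 1≤t t≤T isClass = record
  { len = λ i → trans (length-++ (map F.suc (C i)))
      (trans (cong₂ _+_ (trans (length-map F.suc (C i)) (len i)) (length-replicate (T ∸ t))) (m+[n∸m]≡n t≤T))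
  ; acyclic = λ i (v , j , 2≤j , power) → acyclic i (strip v , j , 2≤j ,
      trans (sym (strip-pad (T ∸ t) (C i))) (trans (cong strip power) (strip-power j v)))
  ; noShifts = noShifts'
  }
  where
  open IsClass isClass
  noShifts' : ∀ i i' → i ≢ i' → ¬ (∃[ c ] (c < T) × (padClass t T C i' ≡ rotate c (padClass t T C i)))
  noShifts' i i' i≢i' (c , _ , shifted) with shadow 1≤t c
  ... | j , sh = noShifts i i' i≢i' (F.toℕ j , toℕ<n j , (begin
    C i'                                  ≡⟨ sym (strip-pad (T ∸ t) (C i')) ⟩
    strip (padClass t T C i')             ≡⟨ cong strip shifted ⟩
    strip (rotate c (padClass t T C i))   ≡⟨ strip-rotate-pad (T ∸ t) (C i) (len i) sh ⟩
    rotate (F.toℕ j) (C i)                ∎))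
    where open ≡-Reasoning

padClass-light : ∀ {t T L m n} (C : Fin m → Word L) → 1 ≤ t → IsClass t L m C →
  Light t L (suc n) m C → Light T (suc L) (T * n + 1) m (padClass t T C)
padClass-light {t} {T} {m = m} {n = n} C 1≤t isClass light (a , distinct , incomparable)
  with pigeonhole n (λ p → proj₂ (a p)) (m<m+n (T * n) (s≤s z≤n))
... | c , e , e-injective , shift-c with shadow 1≤t c
... | j , sh = light (b , b-distinct , b-incomparable)
  where
  open IsClass isClass
  b : Fin (suc n) → Fin m × Fin t
  b q = proj₁ (a (e q)) , j
  b-distinct : ∀ p q → p ≢ q → b p ≢ b q
  b-distinct p q p≢q bp≡bq = distinct (e p) (e q) (λ ep≡eq → p≢q (e-injective ep≡eq))
    (cong₂ _,_ (cong proj₁ bp≡bq) (toℕ-injective (trans (shift-c p) (sym (shift-c q)))))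
  b-incomparable : ∀ p q → ¬ Prec C (b p) (b q)
  b-incomparable p q (gt , i<i') = incomparable (e p) (e q) (padded-gt , i<i')
    where
    i = proj₁ (a (e p))
    i' = proj₁ (a (e q))
    padded-gt : LexGt (rotate (F.toℕ (proj₂ (a (e q)))) (padClass t T C i'))
                      (rotate (F.toℕ (proj₂ (a (e p)))) (padClass t T C i))
    padded-gt = subst₂ (λ x y → LexGt (rotate x (padClass t T C i')) (rotate y (padClass t T C i)))
      (sym (shift-c q)) (sym (shift-c p))
      (lex-rotate-pad (T ∸ t) (C i) (C i') (len i) (len i') sh gt)

padding-attained : ∀ {t T L n m} → 1 ≤ t → t ≤ T →
  Attained t L (suc n) m → Attained T (suc L) (T * n + 1) m
padding-attained {t} {T} 1≤t t≤T (C , isClass , light) =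
  padClass t T C , padClass-isClass C 1≤t t≤T isClass , padClass-light C 1≤t isClass light

lemma5p4p3 : (t l n : ℕ) → 1 ≤ t → t < n →
    ∀ m → Attained t l n m →
    ∃[ m' ] (m ≤ m') × Attained (2 ^ ⌈log₂ t ⌉) (l + 1) (2 ^ ⌈log₂ t ⌉ * (n ∸ 1) + 1) m'
lemma5p4p3 t l zero _ () m _
lemma5p4p3 t l (suc n) 1≤t _ m attained =
  m , ≤-refl , subst (λ L → Attained T L (T * n + 1) m) (+-comm 1 l)
    (padding-attained 1≤t (n≤2^⌈log₂n⌉ t) attained)
  where T = 2 ^ ⌈log₂ t ⌉
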